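{- Let $L \in \{\mathbf{K}, \mathbf{KTB}\}$ and let $\varphi$ be a modal formula whose propositional variables are among $p_1,\ldots,p_n$. Then $\varphi$ is $L$-satisfiable if and only if $\widehat{\varphi}$ is $L$-satisfiable.
   Context: Modal formulas are built from propositional variables $p_1,p_2,\ldots$, $\bot$, $\rightarrow$ and $\Box$, with Kripke semantics as usual. $\mathbf{K}$-satisfiable means satisfied at some world of some Kripke model; $\mathbf{KTB}$-satisfiable means satisfied at some world of some model over a frame whose accessibility relation is reflexive and symmetric. The translation $\cdot'$ is defined recursively by $p_i' = p_i$ for $i\in\{1,\ldots,n\}$, $\bot' = \bot$, $(\phi\rightarrow\psi)' = \phi'\rightarrow\psi'$, $(\Box\phi)' = \Box(p_{n+1}\rightarrow\phi')$; and $\widehat{\varphi} = p_{n+1}\wedge\varphi'$. -}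

module Defs where

open import Data.Nat using (ℕ; suc; _≤_)
open import Data.Bool using (Bool; true)
open import Data.Empty using (⊥)
open import Data.Unit using (⊤)
open import Data.Product using (Σ; _×_)
open import Relation.Binary.PropositionalEquality using (_≡_)

-- Modal formulas: variables p_i (i : ℕ; the paper uses p_1, p_2, ...), ⊥, →, □.
data Form : Set where
  var  : ℕ → Form
  fls  : Form
  _⇒_  : Form → Form → Form
  □_   : Form → Form

infixr 5 _⇒_
infix 7 □_

¬ᶠ_ : Form → Form
¬ᶠ φ = φ ⇒ fls

_∧ᶠ_ : Form → Form → Form
φ ∧ᶠ ψ = ¬ᶠ (φ ⇒ ¬ᶠ ψ)

VarsAmong : ℕ → Form → Set
VarsAmong n (var i)  = (1 ≤ i) × (i ≤ n)
VarsAmong n fls      = ⊤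
VarsAmong n (φ ⇒ ψ)  = VarsAmong n φ × VarsAmong n ψ
VarsAmong n (□ φ)    = VarsAmong n φ

record Model : Set₁ where
  field
    World : Set
    R     : World → World → Set
    V     : ℕ → World → Bool
open Model public

_,_⊨_ : (M : Model) → World M → Form → Set
M , w ⊨ var i   = V M i w ≡ true
M , w ⊨ fls     = ⊥
M , w ⊨ (φ ⇒ ψ) = M , w ⊨ φ → M , w ⊨ ψ
M , w ⊨ (□ φ)   = ∀ v → R M w v → M , v ⊨ φ

data Logic : Set where
  K KTB : Logic

FrameCond : Logic → (M : Model) → Set
FrameCond K   M = ⊤
FrameCond KTB M = (∀ w → R M w w) × (∀ w v → R M w v → R M v w)

Satisfiable : Logic → Form → Set₁
Satisfiable L φ = Σ Model λ M → FrameCond L M × Σ (World M) λ w → M , w ⊨ φ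

tr : ℕ → Form → Form
tr n (var i)  = var i
tr n fls      = fls
tr n (φ ⇒ ψ)  = tr n φ ⇒ tr n ψ
tr n (□ φ)    = □ (var (suc n) ⇒ tr n φ)

hat : ℕ → Form → Form
hat n φ = var (suc n) ∧ᶠ tr n φ

module Submission where

-- The translation φ ↦ φ̂ = p_{n+1} ∧ φ' relativises every box to the worlds
-- where the fresh variable p_{n+1} holds.  Both directions of the theorem are
-- model transformations that keep the frame (up to restriction) and hence
-- the frame conditions of K and KTB:
--   (⇒) Make p_{n+1} true everywhere.  Since φ only mentions p_1,…,p_n its
--       truth is unchanged (agreement lemma), and in a model where p_{n+1}
--       holds at every world, φ and φ' are equivalent (the guards are idle).
--   (⇐) Restrict the model to the worlds satisfying p_{n+1}.  Truth of φ in
--       the restriction coincides with truth of φ' in the original model, for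
--       every formula φ.  Reflexivity and symmetry survive restriction.
-- Extracting the two conjuncts of p_{n+1} ∧ φ' from the classical encoding of
-- ∧ uses that truth at a world is stable under double negation, which holds
-- because valuations are Boolean.

open import Defs
open import Data.Nat using (ℕ; suc; _≤_; _≟_; s≤s)
open import Data.Nat.Properties using (<⇒≢)
open import Data.Bool using (Bool; true; false)
open import Data.Empty using (⊥-elim)
open import Data.Unit using (tt)
open import Data.Product using (Σ; _×_; _,_; proj₁; proj₂)
open import Function using (_⇔_; mk⇔; Equivalence)
open import Relation.Nullary using (¬_; yes; no)
open import Relation.Binary.PropositionalEquality using (_≡_; _≢_; refl)

open Equivalence using (to; from)

-- Truth at a world is ¬¬-stable: atoms are decided by a Boolean valuation
-- and all other connectives are built from → , ⊥ and ∀.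
⊨-stable : ∀ M w φ → ¬ ¬ (M , w ⊨ φ) → M , w ⊨ φ
⊨-stable M w (var i) nn with V M i w
... | true  = refl
... | false = ⊥-elim (nn (λ ()))
⊨-stable M w fls nn = nn (λ x → x)
⊨-stable M w (φ ⇒ ψ) nn a = ⊨-stable M w ψ (λ k → nn (λ f → k (f a)))
⊨-stable M w (□ φ) nn v r = ⊨-stable M v φ (λ k → nn (λ f → k (f v r)))

∧ᶠ-intro : ∀ M w φ ψ → M , w ⊨ φ → M , w ⊨ ψ → M , w ⊨ (φ ∧ᶠ ψ)
∧ᶠ-intro M w φ ψ a b f = f a b

∧ᶠ-elim : ∀ M w φ ψ → M , w ⊨ (φ ∧ᶠ ψ) → (M , w ⊨ φ) × (M , w ⊨ ψ)
∧ᶠ-elim M w φ ψ h =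
  ⊨-stable M w φ (λ k → h (λ a _ → k a)) , ⊨-stable M w ψ (λ k → h (λ _ b → k b))

revalue : (M : Model) → (ℕ → World M → Bool) → Model
revalue M V′ = record M { V = V′ }

agreement : ∀ n M (V′ : ℕ → World M → Bool) → (∀ i w → i ≤ n → V′ i w ≡ V M i w) →
  ∀ φ → VarsAmong n φ → ∀ w → M , w ⊨ φ ⇔ revalue M V′ , w ⊨ φ
agreement n M V′ same (var i) (_ , i≤n) w with V′ i w | same i w i≤n
... | _ | refl = mk⇔ (λ x → x) (λ x → x)
agreement n M V′ same fls _ w = mk⇔ (λ x → x) (λ x → x)
agreement n M V′ same (φ ⇒ ψ) (vφ , vψ) w =
  mk⇔ (λ f x → to (IHψ w) (f (from (IHφ w) x)))
      (λ f x → from (IHψ w) (f (to (IHφ w) x)))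
  where IHφ = agreement n M V′ same φ vφ
        IHψ = agreement n M V′ same ψ vψ
agreement n M V′ same (□ φ) vφ w =
  mk⇔ (λ f v r → to (IH v) (f v r)) (λ f v r → from (IH v) (f v r))
  where IH = agreement n M V′ same φ vφ

setTrue : (M : Model) → ℕ → ℕ → World M → Bool
setTrue M k i w with i ≟ k
... | yes _ = true
... | no  _ = V M i w

setTrue-at : ∀ M k w → setTrue M k k w ≡ true
setTrue-at M k w with k ≟ k
... | yes _ = refl
... | no k≢k = ⊥-elim (k≢k refl)

setTrue-away : ∀ M k i w → i ≢ k → setTrue M k i w ≡ V M i w
setTrue-away M k i w i≢k with i ≟ k
... | yes i≡k = ⊥-elim (i≢k i≡k)
... | no  _   = refl

translation-transparent : ∀ n M → (∀ w → M , w ⊨ var (suc n)) →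
  ∀ φ w → M , w ⊨ φ ⇔ M , w ⊨ tr n φ
translation-transparent n M guard (var i) w = mk⇔ (λ x → x) (λ x → x)
translation-transparent n M guard fls w = mk⇔ (λ x → x) (λ x → x)
translation-transparent n M guard (φ ⇒ ψ) w =
  mk⇔ (λ f x → to (IHψ w) (f (from (IHφ w) x)))
      (λ f x → from (IHψ w) (f (to (IHφ w) x)))
  where IHφ = translation-transparent n M guard φ
        IHψ = translation-transparent n M guard ψ
translation-transparent n M guard (□ φ) w =
  mk⇔ (λ f v r _ → to (IH v) (f v r)) (λ f v r → from (IH v) (f v r (guard v)))
  where IH = translation-transparent n M guard φ

restrict : Model → ℕ → Model
restrict M k = record
  { World = Σ (World M) (λ u → M , u ⊨ var k)
  ; R     = λ a b → R M (proj₁ a) (proj₁ b)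
  ; V     = λ i a → V M i (proj₁ a)
  }

restrict-tr : ∀ n M φ (a : World (restrict M (suc n))) →
  restrict M (suc n) , a ⊨ φ ⇔ M , proj₁ a ⊨ tr n φ
restrict-tr n M (var i) a = mk⇔ (λ x → x) (λ x → x)
restrict-tr n M fls a = mk⇔ (λ x → x) (λ x → x)
restrict-tr n M (φ ⇒ ψ) a =
  mk⇔ (λ f x → to (IHψ a) (f (from (IHφ a) x)))
      (λ f x → from (IHψ a) (f (to (IHφ a) x)))
  where IHφ = restrict-tr n M φ
        IHψ = restrict-tr n M ψ
restrict-tr n M (□ φ) a =
  mk⇔ (λ f v r pv → to (IH (v , pv)) (f (v , pv) r))
      (λ f b r → from (IH b) (f (proj₁ b) r (proj₂ b)))
  where IH = restrict-tr n M φ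

-- Frame conditions depend only on the frame, so they survive a change of
-- valuation; reflexivity and symmetry are universal, so they survive restriction.
revalue-frame : ∀ L M V′ → FrameCond L M → FrameCond L (revalue M V′)
revalue-frame K   M V′ fc = tt
revalue-frame KTB M V′ fc = fc

restrict-frame : ∀ L M k → FrameCond L M → FrameCond L (restrict M k)
restrict-frame K   M k fc = tt
restrict-frame KTB M k (refl-R , sym-R) =
  (λ a → refl-R (proj₁ a)) , (λ a b r → sym-R (proj₁ a) (proj₁ b) r)

lemma2 : (L : Logic) (n : ℕ) (φ : Form) → VarsAmong n φ →
    (Satisfiable L φ → Satisfiable L (hat n φ)) × (Satisfiable L (hat n φ) → Satisfiable L φ)
lemma2 L n φ vars = forward , backward
  where
  forward : Satisfiable L φ → Satisfiable L (hat n φ)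
  forward (M , fc , w , sat) =
    M′ , revalue-frame L M V′ fc , w ,
    ∧ᶠ-intro M′ w (var (suc n)) (tr n φ) (guard w)
      (to (translation-transparent n M′ guard φ w) (to (agreement n M V′ low φ vars w) sat))
    where
    V′ = setTrue M (suc n)
    M′ = revalue M V′
    guard : ∀ u → M′ , u ⊨ var (suc n)
    guard = setTrue-at M (suc n)
    low : ∀ i u → i ≤ n → V′ i u ≡ V M i u
    low i u i≤n = setTrue-away M (suc n) i u (<⇒≢ (s≤s i≤n))

  backward : Satisfiable L (hat n φ) → Satisfiable L φ
  backward (M , fc , w , sat) with ∧ᶠ-elim M w (var (suc n)) (tr n φ) sat
  ... | guard , sat′ =
    restrict M (suc n) , restrict-frame L M (suc n) fc , (w , guard) ,
    from (restrict-tr n M φ (w , guard)) sat′
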